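{- Let $N$ be a network on $X$ containing no $2$-alternating cycle. If $x,y\in X$ share an ancestor in $N$, then $x$ and $y$ have a unique least common ancestor in $N$. In particular, in an arboreal network any two leaves that share an ancestor have a unique least common ancestor.
   Context: In a digraph, a leaf is a vertex of indegree 1 and outdegree 0, a root is a vertex of indegree 0. A network on $X$ ($|X|\ge2$) is a simple acyclic digraph $N$ whose underlying undirected graph is connected, whose set of leaves is $X$, in which every vertex of indegree 0 has outdegree at least 2, every vertex of outdegree 0 has indegree 1, and no vertex has both indegree and outdegree equal to 1. $N$ is arboreal if its underlying undirected graph is a tree. $v$ is an ancestor of $w$ if there is a directed path (possibly of length 0) from $v$ to $w$; $x,y$ share an ancestor if some vertex is an ancestor of both. A least common ancestor of $x,y$ is a vertex that is an ancestor of both and none of whose children is an ancestor of both. A hybrid vertex is a vertex of indegree at least 2. A $2$-alternating cycle is a sequence $v_1,h_1,v_2,h_2$ of vertices with $h_1,h_2$ hybrid vertices such that there are internally vertex-disjoint directed paths from $v_1$ to $h_1$ and from $v_2$ to $h_1$, and internally vertex-disjoint directed paths from $v_2$ to $h_2$ and from $v_1$ to $h_2$. -}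

module Defs where

open import Data.Nat using (ℕ; zero; suc; _+_; _≤_)
open import Data.Fin using (Fin)
open import Data.Bool using (Bool; true; false; if_then_else_)
open import Data.List using (List; []; _∷_; _++_; map; allFin)
open import Data.Nat.ListAction using (sum)
open import Data.List.Membership.Propositional using (_∈_)
open import Data.Product using (Σ; ∃; _×_; _,_)
open import Data.Sum using (_⊎_)
open import Data.Empty using (⊥)
open import Relation.Nullary using (¬_)
open import Relation.Binary.PropositionalEquality using (_≡_; _≢_)
open import Relation.Binary.Construct.Closure.ReflexiveTransitive using (Star)

-- A finite digraph on vertex set Fin n, given by a Boolean adjacency
-- matrix (so there are no parallel arcs).
record Digraph : Set where
  field
    n : ℕ
    E : Fin n → Fin n → Bool

module _ (G : Digraph) where
  open Digraph G

  V : Set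
  V = Fin n

  Arc : V → V → Set
  Arc u v = E u v ≡ true

  indeg : V → ℕ
  indeg v = sum (map (λ u → if E u v then 1 else 0) (allFin n))

  outdeg : V → ℕ
  outdeg u = sum (map (λ v → if E u v then 1 else 0) (allFin n))

  data Path : V → V → Set where
    stop : ∀ {v} → Path v v
    step : ∀ {u w v} → Arc u w → Path w v → Path u v

  initVerts : ∀ {u v} → Path u v → List V
  initVerts stop = []
  initVerts (step {u} _ p) = u ∷ initVerts p

  inner : ∀ {u v} → Path u v → List V
  inner stop = []
  inner (step _ p) = initVerts p

  InternallyDisjoint : ∀ {a b c d} → Path a b → Path c d → Set
  InternallyDisjoint p q = ∀ z → z ∈ inner p → z ∈ inner q → ⊥

  Ancestor : V → V → Set
  Ancestor v w = Path v w

  Leaf : V → Set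
  Leaf v = indeg v ≡ 1 × outdeg v ≡ 0

  Hybrid : V → Set
  Hybrid v = 2 ≤ indeg v

  Adj : V → V → Set
  Adj u v = Arc u v ⊎ Arc v u

  Connected : Set
  Connected = ∀ u v → Star Adj u v

  Acyclic : Set
  Acyclic = ∀ u v → Arc u v → ¬ Path v u

  Loopless : Set
  Loopless = ∀ v → E v v ≡ false

  data Distinct : List V → Set where
    []  : Distinct []
    _∷_ : ∀ {x xs} → (¬ x ∈ xs) → Distinct xs → Distinct (x ∷ xs)

  data AdjChain : List V → Set where
    one  : ∀ {x} → AdjChain (x ∷ [])
    more : ∀ {x y xs} → Adj x y → AdjChain (y ∷ xs) → AdjChain (x ∷ y ∷ xs)

  HasUndirectedCycle : Set
  HasUndirectedCycle = Σ V λ x₀ → Σ V λ a → Σ V λ b → Σ (List V) λ rest →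
    AdjChain (x₀ ∷ a ∷ b ∷ rest ++ x₀ ∷ []) × Distinct (x₀ ∷ a ∷ b ∷ rest)

  record IsNetwork : Set where
    field
      loopless     : Loopless
      acyclic      : Acyclic
      connected    : Connected
      twoLeaves    : Σ V λ x → Σ V λ y → x ≢ y × Leaf x × Leaf y
      rootOut      : ∀ v → indeg v ≡ 0 → 2 ≤ outdeg v
      sinkIn       : ∀ v → outdeg v ≡ 0 → indeg v ≡ 1
      noDeg11      : ∀ v → ¬ (indeg v ≡ 1 × outdeg v ≡ 1)

  Arboreal : Set
  Arboreal = IsNetwork × ¬ HasUndirectedCycle

  TwoAlternatingCycle : Set
  TwoAlternatingCycle =
    Σ V λ v₁ → Σ V λ h₁ → Σ V λ v₂ → Σ V λ h₂ →
      Distinct (v₁ ∷ h₁ ∷ v₂ ∷ h₂ ∷ []) × Hybrid h₁ × Hybrid h₂ ×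
      (Σ (Path v₁ h₁) λ p → Σ (Path v₂ h₁) λ q → InternallyDisjoint p q) ×
      (Σ (Path v₂ h₂) λ p → Σ (Path v₁ h₂) λ q → InternallyDisjoint p q)

  ShareAncestor : V → V → Set
  ShareAncestor x y = Σ V λ v → Ancestor v x × Ancestor v y

  LCA : V → V → V → Set
  LCA x y v = Ancestor v x × Ancestor v y ×
              (∀ c → Arc v c → ¬ (Ancestor c x × Ancestor c y))

  UniqueLCA : V → V → Set
  UniqueLCA x y = Σ V λ v → LCA x y v × (∀ w → LCA x y w → w ≡ v)

{-# OPTIONS --safe #-}
-- Existence: in an acyclic finite digraph one can walk down from a common
-- ancestor of x and y, along children that are still common ancestors,
-- until no child is; paths have fewer than n arcs, so this stops.
-- Uniqueness: let v₁ ≠ v₂ be least common ancestors. Neither is an ancestor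
-- of the other, so paths v₁ ⇝ x and v₂ ⇝ x first meet in a vertex h₁ ≠ v₁, v₂
-- entered from two different vertices, i.e. a hybrid; likewise for y and
-- some h₂. Since h₁ is a proper descendant of v₁ and an ancestor of x, it is
-- not an ancestor of y, so h₁ ≠ h₂ and v₁,h₁,v₂,h₂ is a 2-alternating cycle.
-- In the arboreal case the two in-neighbours of h₁ are joined by the walk
-- back to v₁, down to y, up to v₂ and down again, which misses h₁; together
-- with h₁ it closes an undirected cycle.
module Submission where

open import Defs
open import Data.Bool using (true; if_then_else_)
import Data.Bool.Properties as Bool
open import Data.Empty using (⊥-elim)
import Data.Fin as Fin
open import Data.Fin using (Fin)
open import Data.Fin.Properties using (pigeonhole; _≟_)
open import Data.List using (List; []; _∷_; _++_; map; allFin; length; lookup)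
open import Data.List.Membership.Propositional using (_∈_; _∉_; lose)
open import Data.List.Membership.Propositional.Properties using (∈-allFin; ∈-lookup)
open import Data.List.Relation.Binary.Subset.Propositional using (_⊆_)
open import Data.List.Relation.Unary.All using ([]; _∷_)
open import Data.List.Relation.Unary.All.Properties using (All¬⇒¬Any)
open import Data.List.Relation.Unary.Any using (Any; here; there; any?; satisfied)
open import Data.Nat using (ℕ; zero; suc; _+_; _≤_; _<_; s≤s; z≤n)
open import Data.Nat.ListAction using (sum)
open import Data.Nat.Properties
  using (≤-refl; ≤-trans; ≤-reflexive; <⇒≤; <⇒≱; m≤m+n; m≤n+m; +-comm; +-suc; +-identityʳ; +-monoʳ-≤; _≤?_; ≰⇒>)
open import Data.Sum using (inj₁; inj₂)
open import Data.Product using (Σ; ∃; _×_; _,_; proj₁; proj₂)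
open import Function using (_∘_)
open import Relation.Binary.Construct.Closure.ReflexiveTransitive using (Star; ε; _◅_; _◅◅_)
open import Relation.Binary.PropositionalEquality using (_≡_; _≢_; refl; sym; trans; subst; cong; cong₂)
open import Relation.Nullary using (¬_; Dec; yes; no)
open import Relation.Nullary.Decidable using (_×-dec_; decidable-stable)
open import Relation.Unary using (Decidable)

sum-map-∈ : ∀ {A : Set} (f : A → ℕ) {x xs} → x ∈ xs → f x ≤ sum (map f xs)
sum-map-∈ f {xs = x ∷ xs} (here refl) = m≤m+n (f x) _
sum-map-∈ f {xs = z ∷ xs} (there x∈xs) = ≤-trans (sum-map-∈ f x∈xs) (m≤n+m _ (f z))

sum-map-∈₂ : ∀ {A : Set} (f : A → ℕ) {x y xs} → x ∈ xs → y ∈ xs → x ≢ y →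
             f x + f y ≤ sum (map f xs)
sum-map-∈₂ f (here refl) (here refl) x≢y = ⊥-elim (x≢y refl)
sum-map-∈₂ f {x} (here refl) (there y∈xs) _ = +-monoʳ-≤ (f x) (sum-map-∈ f y∈xs)
sum-map-∈₂ f {x} {y} (there x∈xs) (here refl) _ =
  ≤-trans (≤-reflexive (+-comm (f x) (f y))) (+-monoʳ-≤ (f y) (sum-map-∈ f x∈xs))
sum-map-∈₂ f {xs = z ∷ xs} (there x∈xs) (there y∈xs) x≢y =
  ≤-trans (sum-map-∈₂ f x∈xs y∈xs x≢y) (m≤n+m _ (f z))

module _ (N : Digraph) where
  open Digraph N using (n; E)
  open import Data.List.Membership.DecPropositional (_≟_ {n}) using (_∈?_)

  verts : ∀ {a b} → Path N a b → List (V N)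
  verts {a} stop = a ∷ []
  verts (step {u} _ p) = u ∷ verts p

  len : ∀ {a b} → Path N a b → ℕ
  len stop = 0
  len (step _ p) = suc (len p)

  _++ₚ_ : ∀ {a b c} → Path N a b → Path N b c → Path N a c
  stop ++ₚ q = q
  step e p ++ₚ q = step e (p ++ₚ q)

  _▷_ : ∀ {a b c} → Path N a b → Arc N b c → Path N a c
  stop ▷ e = step e stop
  step e′ p ▷ e = step e′ (p ▷ e)

  len-▷ : ∀ {a b c} (p : Path N a b) (e : Arc N b c) → len (p ▷ e) ≡ suc (len p)
  len-▷ stop e = refl
  len-▷ (step _ p) e = cong suc (len-▷ p e)

  length-verts : ∀ {a b} (p : Path N a b) → length (verts p) ≡ suc (len p)
  length-verts stop = refl
  length-verts (step _ p) = cong suc (length-verts p)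

  source∈verts : ∀ {a b} (p : Path N a b) → a ∈ verts p
  source∈verts stop = here refl
  source∈verts (step _ p) = here refl

  target∈verts : ∀ {a b} (p : Path N a b) → b ∈ verts p
  target∈verts stop = here refl
  target∈verts (step _ p) = there (target∈verts p)

  initVerts⊆verts : ∀ {a b} (p : Path N a b) → initVerts N p ⊆ verts p
  initVerts⊆verts (step _ p) (here refl) = here refl
  initVerts⊆verts (step _ p) (there z∈p) = there (initVerts⊆verts p z∈p)

  inner⊆initVerts : ∀ {a b} (p : Path N a b) → inner N p ⊆ initVerts N p
  inner⊆initVerts (step _ p) z∈p = there z∈p

  prefixTo : ∀ {a b z} (p : Path N a b) → z ∈ verts p → Path N a z
  prefixTo stop (here refl) = stop
  prefixTo (step e p) (here refl) = stop
  prefixTo (step e p) (there z∈p) = step e (prefixTo p z∈p)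

  suffixFrom : ∀ {a b z} (p : Path N a b) → z ∈ verts p → Path N z b
  suffixFrom stop (here refl) = stop
  suffixFrom (step e p) (here refl) = step e p
  suffixFrom (step e p) (there z∈p) = suffixFrom p z∈p

  record LastArc {a h} (p : Path N a h) : Set where
    field
      penultimate : V N
      toPenultimate : Path N a penultimate
      arc : Arc N penultimate h
      toPenultimate⊆ : verts toPenultimate ⊆ initVerts N p

  lastArc-step : ∀ {a w h} (e : Arc N a w) (p : Path N w h) → LastArc (step e p)
  lastArc-step e stop = record { toPenultimate = stop ; arc = e ; toPenultimate⊆ = λ z∈ → z∈ }
  lastArc-step e (step e′ p) = record
    { toPenultimate = step e L.toPenultimate
    ; arc = L.arc
    ; toPenultimate⊆ = λ { (here refl) → here refl ; (there z∈) → there (L.toPenultimate⊆ z∈) }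
    }
    where module L = LastArc (lastArc-step e′ p)

  lastArc : ∀ {a h} (p : Path N a h) → a ≢ h → LastArc p
  lastArc stop a≢a = ⊥-elim (a≢a refl)
  lastArc (step e p) _ = lastArc-step e p

  in-neighbours⇒hybrid : ∀ {u w h} → u ≢ w → Arc N u h → Arc N w h → Hybrid N h
  in-neighbours⇒hybrid {u} {w} {h} u≢w u→h w→h = begin
    2                 ≡⟨ cong₂ _+_ (sym (counts u→h)) (sym (counts w→h)) ⟩
    count u + count w ≤⟨ sum-map-∈₂ count (∈-allFin u) (∈-allFin w) u≢w ⟩
    indeg N h         ∎
    where
    open Data.Nat.Properties.≤-Reasoning
    count : V N → ℕ
    count z = if E z h then 1 else 0
    counts : ∀ {z} → Arc N z h → count z ≡ 1
    counts z→h = cong (λ b → if b then 1 else 0) z→h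

  record FirstHit (P : V N → Set) {a b} (p : Path N a b) : Set where
    field
      hit : V N
      P-hit : P hit
      before : Path N a hit
      after : Path N hit b
      before-avoids : ∀ {z} → z ∈ initVerts N before → ¬ P z
      before⊆ : verts before ⊆ verts p

  firstHit : ∀ {P : V N → Set} → Decidable P → ∀ {a b} (p : Path N a b) → Any P (verts p) → FirstHit P p
  firstHit P? {a} p P∈p with P? a
  ... | yes Pa = record
    { P-hit = Pa ; before = stop ; after = p ; before-avoids = λ ()
    ; before⊆ = λ { (here refl) → source∈verts p } }
  firstHit P? stop (here Pa) | no ¬Pa = ⊥-elim (¬Pa Pa)
  firstHit P? (step e p) (here Pa) | no ¬Pa = ⊥-elim (¬Pa Pa)
  firstHit P? (step e p) (there P∈p) | no ¬Pa = record
    { P-hit = H.P-hit ; before = step e H.before ; after = H.after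
    ; before-avoids = λ { (here refl) → ¬Pa ; (there z∈) → H.before-avoids z∈ }
    ; before⊆ = λ { (here refl) → here refl ; (there z∈) → there (H.before⊆ z∈) }
    }
    where module H = FirstHit (firstHit P? p P∈p)

  firstOccurrence : ∀ {a b z} (p : Path N a b) → z ∈ verts p →
                    Σ (Path N a z) λ q → z ∉ initVerts N q × verts q ⊆ verts p
  firstOccurrence {z = z} p z∈p with firstHit (z ≟_) p z∈p
  ... | record { P-hit = refl ; before = q ; before-avoids = avoids ; before⊆ = q⊆p } =
    q , (λ z∈q → avoids z∈q refl) , q⊆p

  record Junction (a b t : V N) : Set where
    field
      h : V N
      fromA : Path N a h
      fromB : Path N b h
      toT : Path N h t
      a≢h : a ≢ h
      b≢h : b ≢ h
      disjoint : InternallyDisjoint N fromA fromB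
      u w : V N
      u→h : Arc N u h
      w→h : Arc N w h
      u≢w : u ≢ w
      toU : Path N a u
      toW : Path N b w
      h∉toU : h ∉ verts toU
      h∉toW : h ∉ verts toW

    hybrid : Hybrid N h
    hybrid = in-neighbours⇒hybrid u≢w u→h w→h

  -- h is the first vertex of pa on pb, and fromB runs along pb up to its first visit of h.
  junction : ∀ {a b t} → ¬ Path N a b → ¬ Path N b a → Path N a t → (pb : Path N b t) → Junction a b t
  junction {a} {b} a↛b b↛a pa pb = record
    { fromA = A ; fromB = B ; toT = toT ; a≢h = a≢h ; b≢h = b≢h
    ; disjoint = λ z z∈A z∈B →
        A-avoids-pb (inner⊆initVerts A z∈A) (B⊆pb (initVerts⊆verts B (inner⊆initVerts B z∈B)))
    ; u→h = LA.arc ; w→h = LB.arc ; u≢w = u≢w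
    ; toU = LA.toPenultimate ; toW = LB.toPenultimate
    ; h∉toU = λ h∈ → A-avoids-pb (LA.toPenultimate⊆ h∈) h∈pb
    ; h∉toW = λ h∈ → h∉B (LB.toPenultimate⊆ h∈)
    }
    where
    open FirstHit (firstHit (_∈? verts pb) pa (lose (target∈verts pa) (target∈verts pb)))
      renaming (hit to h; P-hit to h∈pb; before to A; after to toT; before-avoids to A-avoids-pb)
    B : Path N b h
    B = proj₁ (firstOccurrence pb h∈pb)
    h∉B : h ∉ initVerts N B
    h∉B = proj₁ (proj₂ (firstOccurrence pb h∈pb))
    B⊆pb : verts B ⊆ verts pb
    B⊆pb = proj₂ (proj₂ (firstOccurrence pb h∈pb))
    a≢h : a ≢ h
    a≢h a≡h = b↛a (subst (Path N b) (sym a≡h) B)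
    b≢h : b ≢ h
    b≢h b≡h = a↛b (subst (Path N a) (sym b≡h) A)
    module LA = LastArc (lastArc A a≢h)
    module LB = LastArc (lastArc B b≢h)
    u≢w : LA.penultimate ≢ LB.penultimate
    u≢w u≡w = A-avoids-pb (LA.toPenultimate⊆ (target∈verts LA.toPenultimate))
      (subst (_∈ verts pb) (sym u≡w) (B⊆pb (initVerts⊆verts B (LB.toPenultimate⊆ (target∈verts LB.toPenultimate)))))

  Distinct⇒lookup≢ : ∀ {xs} → Distinct N xs → (i j : Fin (length xs)) → i Fin.< j → lookup xs i ≢ lookup xs j
  Distinct⇒lookup≢ {x ∷ xs} (x∉xs ∷ _) Fin.zero (Fin.suc j) _ x≡ = x∉xs (subst (_∈ xs) (sym x≡) (∈-lookup j))
  Distinct⇒lookup≢ {x ∷ xs} (_ ∷ d) (Fin.suc i) (Fin.suc j) (s≤s i<j) = Distinct⇒lookup≢ d i j i<j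

  Distinct⇒length≤n : ∀ {xs} → Distinct N xs → length xs ≤ n
  Distinct⇒length≤n {xs} d with length xs ≤? n
  ... | yes ≤n = ≤n
  ... | no ≰n with pigeonhole (≰⇒> ≰n) (lookup xs)
  ... | i , j , i<j , same = ⊥-elim (Distinct⇒lookup≢ d i j i<j same)

  Arc? : ∀ u v → Dec (Arc N u v)
  Arc? u v = E u v Bool.≟ true

  pathWithin? : ∀ k a b → Dec (Σ (Path N a b) λ p → len p ≤ k)
  pathWithin? k a b with a ≟ b
  ... | yes refl = yes (stop , z≤n)
  pathWithin? zero a b | no a≢b = no λ { (stop , _) → a≢b refl ; (step _ _ , ()) }
  pathWithin? (suc k) a b | no a≢b with any? (λ c → Arc? a c ×-dec pathWithin? k c b) (allFin n)
  ... | yes found with satisfied found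
  ... | c , e , p , len≤k = yes (step e p , s≤s len≤k)
  pathWithin? (suc k) a b | no a≢b | no none = no λ
    { (stop , _) → a≢b refl
    ; (step {w = c} e p , s≤s len≤k) → none (lose (∈-allFin c) (e , p , len≤k))
    }

  module _ (acyclic : Acyclic N) where

    verts-Distinct : ∀ {a b} (p : Path N a b) → Distinct N (verts p)
    verts-Distinct stop = (λ ()) ∷ []
    verts-Distinct (step {u} {w} e p) = (λ u∈p → acyclic u w e (prefixTo p u∈p)) ∷ verts-Distinct p

    len<n : ∀ {a b} (p : Path N a b) → len p < n
    len<n p = subst (_≤ n) (length-verts p) (Distinct⇒length≤n (verts-Distinct p))

    Path? : ∀ a b → Dec (Path N a b)
    Path? a b with pathWithin? n a b
    ... | yes (p , _) = yes p
    ... | no none = no λ p → none (p , <⇒≤ (len<n p))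

    -- The invariant n ≤ len p + k rules out running out of fuel, since paths have fewer than n arcs.
    minimal : ∀ {P : V N → Set} → Decidable P → ∀ {v} → P v → ∃ λ w → P w × (∀ c → Arc N w c → ¬ P c)
    minimal {P} P? = descend n stop ≤-refl
      where
      descend : ∀ k {v₀ v} (p : Path N v₀ v) → n ≤ len p + k → P v → ∃ λ w → P w × (∀ c → Arc N w c → ¬ P c)
      descend zero p n≤len _ = ⊥-elim (<⇒≱ (len<n p) (subst (n ≤_) (+-identityʳ (len p)) n≤len))
      descend (suc k) {v = v} p n≤len Pv with any? (λ c → Arc? v c ×-dec P? c) (allFin n)
      ... | no none = v , Pv , λ c e Pc → none (lose (∈-allFin c) (e , Pc))
      ... | yes found with satisfied found
      ... | c , e , Pc = descend k (p ▷ e) (subst (n ≤_) len-grows n≤len) Pc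
        where
        len-grows : len p + suc k ≡ len (p ▷ e) + k
        len-grows = trans (+-suc (len p) k) (cong (_+ k) (sym (len-▷ p e)))

    LCA-exists : ∀ {x y} → ShareAncestor N x y → ∃ (LCA N x y)
    LCA-exists {x} {y} (v , v⇝x , v⇝y) with minimal (λ c → Path? c x ×-dec Path? c y) (v⇝x , v⇝y)
    ... | w , (w⇝x , w⇝y) , no-child = w , w⇝x , w⇝y , no-child

  LCA-minimal : ∀ {x y v w} → LCA N x y v → (p : Path N v w) → v ≢ w → Path N w x → ¬ Path N w y
  LCA-minimal _ stop v≢v _ _ = v≢v refl
  LCA-minimal (_ , _ , no-child) (step {w = c} e p) _ w⇝x w⇝y = no-child c e (p ++ₚ w⇝x , p ++ₚ w⇝y)

  LCA-incomparable : ∀ {x y v w} → LCA N x y v → LCA N x y w → v ≢ w → ¬ Path N v w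
  LCA-incomparable lv (w⇝x , w⇝y , _) v≢w v⇝w = LCA-minimal lv v⇝w v≢w w⇝x w⇝y

  junctionOfLCAs : ∀ {x y v₁ v₂ t} → LCA N x y v₁ → LCA N x y v₂ → v₁ ≢ v₂ →
                   Path N v₁ t → Path N v₂ t → Junction v₁ v₂ t
  junctionOfLCAs l₁ l₂ v₁≢v₂ =
    junction (LCA-incomparable l₁ l₂ v₁≢v₂) (LCA-incomparable l₂ l₁ (v₁≢v₂ ∘ sym))

  distinct₄ : ∀ {a b c d} → a ≢ b → a ≢ c → a ≢ d → b ≢ c → b ≢ d → c ≢ d → Distinct N (a ∷ b ∷ c ∷ d ∷ [])
  distinct₄ a≢b a≢c a≢d b≢c b≢d c≢d =
    All¬⇒¬Any (a≢b ∷ a≢c ∷ a≢d ∷ []) ∷ All¬⇒¬Any (b≢c ∷ b≢d ∷ []) ∷ All¬⇒¬Any (c≢d ∷ []) ∷ (λ ()) ∷ []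

  distinctLCAs⇒twoAlternatingCycle : ∀ {x y v₁ v₂} → LCA N x y v₁ → LCA N x y v₂ → v₁ ≢ v₂ →
                                     TwoAlternatingCycle N
  distinctLCAs⇒twoAlternatingCycle {x} {y} {v₁} {v₂} l₁@(v₁⇝x , v₁⇝y , _) l₂@(v₂⇝x , v₂⇝y , _) v₁≢v₂ =
    v₁ , J.h , v₂ , K.h ,
    distinct₄ J.a≢h v₁≢v₂ K.b≢h (J.b≢h ∘ sym) h₁≢h₂ K.a≢h ,
    J.hybrid , K.hybrid , (J.fromA , J.fromB , J.disjoint) , (K.fromA , K.fromB , K.disjoint)
    where
    module J = Junction (junctionOfLCAs l₁ l₂ v₁≢v₂ v₁⇝x v₂⇝x)
    module K = Junction (junctionOfLCAs l₂ l₁ (v₁≢v₂ ∘ sym) v₂⇝y v₁⇝y)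
    h₁≢h₂ : J.h ≢ K.h
    h₁≢h₂ h₁≡h₂ = LCA-minimal l₁ J.fromA J.a≢h J.toT (subst (λ z → Path N z y) (sym h₁≡h₂) K.toT)

  Walk : V N → V N → Set
  Walk = Star (Adj N)

  walkTail : ∀ {a b} → Walk a b → List (V N)
  walkTail ε = []
  walkTail (_◅_ {j = w} _ W) = w ∷ walkTail W

  walkVerts : ∀ {a b} → Walk a b → List (V N)
  walkVerts {a} W = a ∷ walkTail W

  forward : ∀ {a b} → Path N a b → Walk a b
  forward stop = ε
  forward (step e p) = inj₁ e ◅ forward p

  backward : ∀ {a b} → Path N a b → Walk b a
  backward stop = ε
  backward (step e p) = backward p ◅◅ (inj₂ e ◅ ε)

  ∉-◅◅ : ∀ {h a b c} (V : Walk a b) {W : Walk b c} → h ∉ walkVerts V → h ∉ walkVerts W → h ∉ walkVerts (V ◅◅ W)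
  ∉-◅◅ ε h∉V h∉W = h∉W
  ∉-◅◅ (_ ◅ V) h∉V h∉W (here h≡a) = h∉V (here h≡a)
  ∉-◅◅ (_ ◅ V) h∉V h∉W (there h∈) = ∉-◅◅ V (h∉V ∘ there) h∉W h∈

  ∉-forward : ∀ {h a b} (p : Path N a b) → h ∉ verts p → h ∉ walkVerts (forward p)
  ∉-forward stop h∉p = h∉p
  ∉-forward (step e p) h∉p (here h≡a) = h∉p (here h≡a)
  ∉-forward (step e p) h∉p (there h∈) = ∉-forward p (h∉p ∘ there) h∈

  ∉-backward : ∀ {h a b} (p : Path N a b) → h ∉ verts p → h ∉ walkVerts (backward p)
  ∉-backward stop h∉p = h∉p
  ∉-backward (step e p) h∉p = ∉-◅◅ (backward p) (∉-backward p (h∉p ∘ there)) λ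
    { (here refl) → h∉p (there (source∈verts p))
    ; (there (here refl)) → h∉p (here refl)
    }

  dropTo : ∀ {a c b} (S : Walk c b) → a ∈ walkVerts S → Distinct N (walkVerts S) →
           Σ (Walk a b) λ S′ → Distinct N (walkVerts S′) × walkVerts S′ ⊆ walkVerts S
  dropTo S (here refl) d = S , d , λ z∈ → z∈
  dropTo (_ ◅ S) (there a∈S) (_ ∷ d) with dropTo S a∈S d
  ... | S′ , d′ , S′⊆S = S′ , d′ , λ z∈ → there (S′⊆S z∈)

  shorten : ∀ {a b} (W : Walk a b) → Σ (Walk a b) λ S → Distinct N (walkVerts S) × walkVerts S ⊆ walkVerts W
  shorten ε = ε , (λ ()) ∷ [] , λ z∈ → z∈
  shorten {a} (e ◅ W) with shorten W
  ... | S , dS , S⊆W with a ∈? walkVerts S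
  ...   | no a∉S = e ◅ S , a∉S ∷ dS , λ { (here refl) → here refl ; (there z∈) → there (S⊆W z∈) }
  ...   | yes a∈S with dropTo S a∈S dS
  ...     | S′ , dS′ , S′⊆S = S′ , dS′ , λ z∈ → there (S⊆W (S′⊆S z∈))

  chainTo : ∀ {a b h} (W : Walk a b) → Adj N b h → AdjChain N (walkVerts W ++ h ∷ [])
  chainTo ε adj = more adj one
  chainTo (e ◅ W) adj = more e (chainTo W adj)

  inNeighbourWalk⇒cycle : ∀ {u w h} → u ≢ w → Arc N u h → Arc N w h →
                          (W : Walk u w) → h ∉ walkVerts W → HasUndirectedCycle N
  inNeighbourWalk⇒cycle u≢w u→h w→h W h∉W with shorten W
  ... | ε , _ , _ = ⊥-elim (u≢w refl)
  ... | _◅_ {j = b} adj S , d , S⊆W =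
    _ , _ , b , walkTail S , more (inj₂ u→h) (more adj (chainTo S (inj₁ w→h))) , (λ h∈ → h∉W (S⊆W h∈)) ∷ d

  distinctLCAs⇒undirectedCycle : ∀ {x y v₁ v₂} → LCA N x y v₁ → LCA N x y v₂ → v₁ ≢ v₂ → HasUndirectedCycle N
  distinctLCAs⇒undirectedCycle {x} {y} l₁@(v₁⇝x , v₁⇝y , _) l₂@(v₂⇝x , v₂⇝y , _) v₁≢v₂ =
    inNeighbourWalk⇒cycle J.u≢w J.u→h J.w→h
      (backward J.toU ◅◅ forward v₁⇝y ◅◅ backward v₂⇝y ◅◅ forward J.toW)
      (∉-◅◅ (backward J.toU) (∉-backward J.toU J.h∉toU)
        (∉-◅◅ (forward v₁⇝y) (∉-forward v₁⇝y (h∉ l₁ J.fromA J.a≢h v₁⇝y))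
          (∉-◅◅ (backward v₂⇝y) (∉-backward v₂⇝y (h∉ l₂ J.fromB J.b≢h v₂⇝y))
            (∉-forward J.toW J.h∉toW))))
    where
    module J = Junction (junctionOfLCAs l₁ l₂ v₁≢v₂ v₁⇝x v₂⇝x)
    h∉ : ∀ {v} → LCA N x y v → Path N v J.h → v ≢ J.h → (q : Path N v y) → J.h ∉ verts q
    h∉ l v⇝h v≢h q h∈q = LCA-minimal l v⇝h v≢h J.toT (suffixFrom q h∈q)

  LCA-unique : Acyclic N → ∀ {x y} → ShareAncestor N x y →
               (∀ {v w} → LCA N x y v → LCA N x y w → ¬ v ≢ w) → UniqueLCA N x y
  LCA-unique acyclic sh no-two with LCA-exists acyclic sh
  ... | v , lv = v , lv , λ w lw → decidable-stable (w ≟ v) (no-two lw lv)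

proposition7p1 : (∀ (N : Digraph) → IsNetwork N → ¬ TwoAlternatingCycle N →
    ∀ x y → Leaf N x → Leaf N y → ShareAncestor N x y → UniqueLCA N x y)
    × (∀ (N : Digraph) → Arboreal N →
    ∀ x y → Leaf N x → Leaf N y → ShareAncestor N x y → UniqueLCA N x y)
proposition7p1 =
  (λ N network no-cycle _ _ _ _ sh →
     LCA-unique N (IsNetwork.acyclic network) sh λ l₁ l₂ → no-cycle ∘ distinctLCAs⇒twoAlternatingCycle N l₁ l₂) ,
  (λ { N (network , no-cycle) _ _ _ _ sh →
     LCA-unique N (IsNetwork.acyclic network) sh λ l₁ l₂ → no-cycle ∘ distinctLCAs⇒undirectedCycle N l₁ l₂ })
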